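{- For all integers $n\ge m\ge 3$, $\mathrm{opt}^{S}_{W}(G_{n,m}) \ge \left\lceil \frac{(n-2)(m-2)}{2}\right\rceil$.
   Context: $G_{n,m}$ is the rectangular grid with $n$ rows and $m$ columns, squares $(i,j)$. A wall is a unit segment separating two adjacent squares; the grid boundary also acts as a wall. A robot starts on $(1,1)$. A move: choose one of the four directions; the robot slides and stops on the last square before it would cross a wall or leave the grid. A set of walls is a solution of the wall/stop game if for every square there is a sequence of moves from $(1,1)$ after which the robot stands on it. $\mathrm{opt}^{S}_{W}(G_{n,m})$ is the minimum number of walls in such a solution. -}

module Defs where

open import Data.Nat using (ℕ; zero; suc; _<_)
open import Data.Product using (_×_; _,_; ∃)
open import Data.List using (List)
open import Data.List.Membership.Propositional using (_∈_; _∉_)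
open import Data.List.Relation.Unary.All using (All)
open import Data.List.Relation.Unary.Unique.Propositional using (Unique)
open import Relation.Nullary using (¬_)

-- Squares of G_{n,m} are pairs (i , j) of naturals with i < n, j < m,
-- using 0-based indices: (0 , 0) is the paper's square (1,1).
Square : Set
Square = ℕ × ℕ

InGrid : ℕ → ℕ → Square → Set
InGrid n m (i , j) = i < n × j < m

-- An interior wall (unit segment between two adjacent squares).
--   horiz i j : separates (i , j) and (suc i , j)
--   vert  i j : separates (i , j) and (i , suc j)
data Wall : Set where
  horiz : ℕ → ℕ → Wall
  vert  : ℕ → ℕ → Wall

ValidWall : ℕ → ℕ → Wall → Set
ValidWall n m (horiz i j) = suc i < n × j < m
ValidWall n m (vert i j)  = i < n × suc j < m

-- A set of walls of G_{n,m}: a duplicate-free list of valid walls;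
-- its number of walls is its length.
record WallSet (n m : ℕ) : Set where
  field
    walls  : List Wall
    valid  : All (ValidWall n m) walls
    unique : Unique walls
open WallSet public

data Dir : Set where
  up down left right : Dir

data Adj (n m : ℕ) (W : List Wall) : Dir → Square → Square → Set where
  adj-down  : ∀ {i j} → suc i < n → horiz i j ∉ W → Adj n m W down (i , j) (suc i , j)
  adj-up    : ∀ {i j} → horiz i j ∉ W → Adj n m W up (suc i , j) (i , j)
  adj-right : ∀ {i j} → suc j < m → vert i j ∉ W → Adj n m W right (i , j) (i , suc j)
  adj-left  : ∀ {i j} → vert i j ∉ W → Adj n m W left (i , suc j) (i , j)

-- A move: the robot slides in direction d from s and stops at t, the last
-- square before it would cross a wall or leave the grid.
data Slide (n m : ℕ) (W : List Wall) (d : Dir) : Square → Square → Set where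
  stop : ∀ {s} → (∀ u → ¬ Adj n m W d s u) → Slide n m W d s s
  go   : ∀ {s u t} → Adj n m W d s u → Slide n m W d u t → Slide n m W d s t

data Reachable (n m : ℕ) (W : List Wall) : Square → Set where
  start : Reachable n m W (0 , 0)
  move  : ∀ {s t} d → Reachable n m W s → Slide n m W d s t → Reachable n m W t

IsSolution : (n m : ℕ) → WallSet n m → Set
IsSolution n m W = ∀ s → InGrid n m s → Reachable n m (walls W) s

module Submission where

-- Every reachable square other than the start square is the end of
-- some slide, so the robot is stopped there in the direction of that slide.
-- An interior square (not on the boundary of the grid) can only stop the
-- robot because of a wall on one of its own sides; so in a solution every
-- one of the (n-2)(m-2) interior squares touches a wall of the solution.
-- A wall touches exactly two squares, hence (n-2)(m-2) ≤ 2·|W|.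

open import Defs
open import Data.Nat using (ℕ; suc; _+_; _≟_; _≤_; _<_; _∸_; _*_; ⌈_/2⌉; s≤s)
open import Data.Nat.Properties
  using (⌈n/2⌉-mono; n≡⌈n+n/2⌉; +-identityʳ; suc-injective; n<1+n; <-trans; ≤-trans; ≤-reflexive)
open import Data.Fin using (Fin; toℕ; combine; remQuot)
open import Data.Fin.Properties
  using (injective⇒≤; combine-injective; combine-remQuot; toℕ-injective; toℕ<n)
open import Data.Product using (Σ; ∃; _×_; _,_; proj₁; proj₂; uncurry)
open import Data.Sum using (_⊎_; inj₁; inj₂)
open import Data.List using (List; length; lookup)
open import Data.List.Membership.Propositional using (_∈_)
open import Data.List.Relation.Unary.Any using (index)
open import Data.List.Relation.Unary.Any.Properties using (lookup-index)
import Data.List.Membership.DecPropositional as DecMembership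
open import Data.Empty using (⊥-elim)
open import Relation.Nullary using (¬_; yes; no)
open import Relation.Nullary.Decidable using (map′; _×-dec_)
open import Relation.Binary.Definitions using (DecidableEquality)
open import Function.Definitions using (Injective)
open import Relation.Binary.PropositionalEquality
  using (_≡_; refl; sym; trans; cong; cong₂; module ≡-Reasoning)

_≟W_ : DecidableEquality Wall
horiz i j ≟W horiz k l =
  map′ (λ (p , q) → cong₂ horiz p q) (λ { refl → refl , refl }) (i ≟ k ×-dec j ≟ l)
horiz _ _ ≟W vert _ _  = no λ ()
vert _ _  ≟W horiz _ _ = no λ ()
vert i j  ≟W vert k l  =
  map′ (λ (p , q) → cong₂ vert p q) (λ { refl → refl , refl }) (i ≟ k ×-dec j ≟ l)

open DecMembership _≟W_ using (_∈?_)

Blocked : ℕ → ℕ → List Wall → Dir → Square → Set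
Blocked n m W d t = ∀ u → ¬ Adj n m W d t u

slide-blocked : ∀ {n m W d s t} → Slide n m W d s t → Blocked n m W d t
slide-blocked (stop b)   = b
slide-blocked (go _ sl)  = slide-blocked sl

reachable-stopped : ∀ {n m W t} → Reachable n m W t →
  t ≡ (0 , 0) ⊎ ∃ λ d → Blocked n m W d t
reachable-stopped start          = inj₁ refl
reachable-stopped (move d _ sl)  = inj₂ (d , slide-blocked sl)

side : Wall → Fin 2 → Square
side (horiz i j) Fin.zero    = (i , j)
side (horiz i j) (Fin.suc _) = (suc i , j)
side (vert i j)  Fin.zero    = (i , j)
side (vert i j)  (Fin.suc _) = (i , suc j)

Touches : List Wall → Square → Set
Touches W s = Σ Wall λ w → w ∈ W × Σ (Fin 2) λ c → side w c ≡ s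

-- An interior square (i+1, j+1) is blocked only by one of its four own walls:
-- none of the four steps from it leaves the grid.
stopped-interior-touches : ∀ {n m W} i j → suc (suc i) < n → suc (suc j) < m →
  (d : Dir) → Blocked n m W d (suc i , suc j) → Touches W (suc i , suc j)
stopped-interior-touches {W = W} i j i<n j<m down b with horiz (suc i) (suc j) ∈? W
... | yes w∈W = _ , w∈W , Fin.zero , refl
... | no  w∉W = ⊥-elim (b _ (adj-down i<n w∉W))
stopped-interior-touches {W = W} i j i<n j<m up b with horiz i (suc j) ∈? W
... | yes w∈W = _ , w∈W , Fin.suc Fin.zero , refl
... | no  w∉W = ⊥-elim (b _ (adj-up w∉W))
stopped-interior-touches {W = W} i j i<n j<m right b with vert (suc i) (suc j) ∈? W
... | yes w∈W = _ , w∈W , Fin.zero , refl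
... | no  w∉W = ⊥-elim (b _ (adj-right j<m w∉W))
stopped-interior-touches {W = W} i j i<n j<m left b with vert (suc i) j ∈? W
... | yes w∈W = _ , w∈W , Fin.suc Fin.zero , refl
... | no  w∉W = ⊥-elim (b _ (adj-left w∉W))

reachable-interior-touches : ∀ {n m W} i j → suc (suc i) < n → suc (suc j) < m →
  Reachable n m W (suc i , suc j) → Touches W (suc i , suc j)
reachable-interior-touches i j i<n j<m r with reachable-stopped r
... | inj₁ ()
... | inj₂ (d , b) = stopped-interior-touches i j i<n j<m d b

-- Counting: each wall touches two squares, so k distinct squares touching
-- walls of W give k ≤ 2·|W|.  The injection sends a square to the pair
-- (side of its wall, position of its wall in W).
touching-bound : ∀ {k} (W : List Wall) (sq : Fin k → Square) →
  Injective _≡_ _≡_ sq → (∀ x → Touches W (sq x)) → k ≤ 2 * length W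
touching-bound W sq sq-inj touch = injective⇒≤ code-injective
  where
  code : Fin _ → Fin (2 * length W)
  code x with touch x
  ... | _ , w∈W , c , _ = combine c (index w∈W)

  code-injective : Injective _≡_ _≡_ code
  code-injective {x} {y} eq with touch x | touch y
  ... | w , w∈W , c , wc≡sx | v , v∈W , e , ve≡sy
    with refl , same-index ← combine-injective c (index w∈W) e (index v∈W) eq
    = sq-inj (trans (sym wc≡sx) (trans (cong (λ u → side u c) w≡v) ve≡sy))
    where
    w≡v : w ≡ v
    w≡v = trans (lookup-index w∈W)
            (trans (cong (lookup W) same-index) (sym (lookup-index v∈W)))

shift : ∀ {a b} → Fin a × Fin b → Square
shift (x , y) = suc (toℕ x) , suc (toℕ y)

shift-injective : ∀ {a b} → Injective _≡_ _≡_ (shift {a} {b})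
shift-injective eq = cong₂ _,_ (toℕ-injective (suc-injective (cong proj₁ eq)))
                               (toℕ-injective (suc-injective (cong proj₂ eq)))

interior : ∀ a b → Fin (a * b) → Square
interior a b k = shift (remQuot {a} b k)

interior-injective : ∀ a b → Injective _≡_ _≡_ (interior a b)
interior-injective a b {k} {l} eq = begin
  k                                 ≡⟨ sym (combine-remQuot {a} b k) ⟩
  uncurry combine (remQuot {a} b k) ≡⟨ cong (uncurry combine) (shift-injective eq) ⟩
  uncurry combine (remQuot {a} b l) ≡⟨ combine-remQuot {a} b l ⟩
  l                                 ∎
  where open ≡-Reasoning

interior-bound : ∀ {x n} → x < n ∸ 2 → suc (suc x) < n
interior-bound {n = suc (suc n)} x<n = s≤s (s≤s x<n)

half-bound : ∀ {k L} → k ≤ 2 * L → ⌈ k /2⌉ ≤ L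
half-bound {k} {L} k≤2L = ≤-trans (⌈n/2⌉-mono k≤2L) (≤-reflexive ⌈2L/2⌉≡L)
  where
  ⌈2L/2⌉≡L : ⌈ 2 * L /2⌉ ≡ L
  ⌈2L/2⌉≡L = sym (trans (n≡⌈n+n/2⌉ L) (cong (λ r → ⌈ L + r /2⌉) (sym (+-identityʳ L))))

mainTheorem13 : (n m : ℕ) → 3 ≤ m → m ≤ n →
    (W : WallSet n m) → IsSolution n m W →
    ⌈ ((n ∸ 2) * (m ∸ 2)) /2⌉ ≤ length (walls W)
mainTheorem13 n m _ _ W solution =
  half-bound (touching-bound (walls W) (interior a b) (interior-injective a b)
               (λ k → touches (remQuot {a} b k)))
  where
  a = n ∸ 2
  b = m ∸ 2
  touches : (p : Fin a × Fin b) → Touches (walls W) (shift p)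
  touches (x , y) = reachable-interior-touches (toℕ x) (toℕ y) x<n y<m
                      (solution _ (<-trans (n<1+n _) x<n , <-trans (n<1+n _) y<m))
    where
    x<n : suc (suc (toℕ x)) < n
    x<n = interior-bound {n = n} (toℕ<n x)
    y<m : suc (suc (toℕ y)) < m
    y<m = interior-bound {n = m} (toℕ<n y)
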